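{- Let $\Gamma$ be a doubly regular $(m,r)$-team semicomplete multipartite digraph with partite sets $V_1,\dots,V_m$ and parameters $\alpha_s,\beta_s$ as in the context. Let $i\neq j$, $x\in V_i$, $y\in V_j$. Then: (i) if $(x,y)\in A\vec\Gamma$, then $|A_j^+(x)|-|A_i^+(y)|=\beta_1+\beta_2-\alpha_1-\alpha_2$; (ii) if $(x,y)\in E\Gamma$, then $|A_j^+(x)|=|A_i^+(y)|$.
   Context: A digraph has vertex set $V\Gamma$ and arcs $A\Gamma$ (ordered pairs of distinct vertices); its underlying graph joins $x,y$ iff $(x,y)$ or $(y,x)$ is an arc. An $(m,r)$-team semicomplete multipartite digraph ($m,r\geq2$) is a digraph whose underlying graph is the complete multipartite graph with $m$ parts $V_1,\dots,V_m$ each of size $r$. Let $E\Gamma=\{(x,y):(x,y),(y,x)\in A\Gamma\}$, $\vec\Gamma=(V\Gamma,A\Gamma\setminus E\Gamma)$, $A_0,A_1$ the adjacency matrices of $(V\Gamma,E\Gamma)$ and $\vec\Gamma$. A regular such $\Gamma$ is doubly regular if there exist integers $t,\alpha_s,\beta_s,\gamma_s,\eta_s$ ($s=0,1,2$) with $A_iA_j=t\delta_{0,i+j}I+\alpha_{i+j}A_1+\beta_{i+j}A_1^{\top}+\gamma_{i+j}A_0+\eta_{i+j}(J-I-A_1-A_1^{\top}-A_0)$ for all $i,j\in\{0,1\}$. For $x\in V_i$ and $j\neq i$, $A_j^+(x)=\{y\in V_j:(x,y)\in A\vec\Gamma\}$. -}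

module Defs where

open import Data.Nat using (ℕ; zero; suc)
import Data.Nat
open import Data.Fin using (Fin; zero; suc) renaming (_≟_ to _≟F_)
open import Data.Product using (_×_; _,_; proj₁; proj₂; Σ)
open import Data.Bool using (Bool; true; false; _∧_; _∨_; not)
open import Data.Integer using (ℤ; +_; _+_; _-_; _*_; 0ℤ; 1ℤ)
open import Relation.Binary.PropositionalEquality using (_≡_; _≢_)
open import Relation.Nullary using (does)

-- Vertices of an (m,r)-team semicomplete multipartite digraph, labelled so
-- that the partite set V_i is {(i , k) | k : Fin r}.
Vertex : ℕ → ℕ → Set
Vertex m r = Fin m × Fin r

part : ∀ {m r} → Vertex m r → Fin m
part = proj₁

Digraph : ℕ → ℕ → Set
Digraph m r = Vertex m r → Vertex m r → Bool

IsTeamSMD : ∀ {m r} → Digraph m r → Set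
IsTeamSMD {m} {r} arc = (x y : Vertex m r) →
  (part x ≡ part y → arc x y ≡ false) × (part x ≢ part y → (arc x y ∨ arc y x) ≡ true)

sumFin : (n : ℕ) → (Fin n → ℤ) → ℤ
sumFin zero f = 0ℤ
sumFin (suc n) f = f zero + sumFin n (λ k → f (suc k))

countFin : (n : ℕ) → (Fin n → Bool) → ℕ
countFin zero f = zero
countFin (suc n) f with f zero
... | true = suc (countFin n (λ k → f (suc k)))
... | false = countFin n (λ k → f (suc k))

sumℕ : (n : ℕ) → (Fin n → ℕ) → ℕ
sumℕ zero f = zero
sumℕ (suc n) f = f zero Data.Nat.+ sumℕ n (λ k → f (suc k))

sumV : ∀ {m r} → (Vertex m r → ℤ) → ℤ
sumV {m} {r} f = sumFin m (λ i → sumFin r (λ k → f (i , k)))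

countV : ∀ {m r} → (Vertex m r → Bool) → ℕ
countV {m} {r} f = sumℕ m (λ i → countFin r (λ k → f (i , k)))

b2z : Bool → ℤ
b2z true = 1ℤ
b2z false = 0ℤ

Mat : ℕ → ℕ → Set
Mat m r = Vertex m r → Vertex m r → ℤ

_·_ : ∀ {m r} → Mat m r → Mat m r → Mat m r
(A · B) x y = sumV (λ z → A x z * B z y)

_ᵀ : ∀ {m r} → Mat m r → Mat m r
(A ᵀ) x y = A y x

eqV : ∀ {m r} → Vertex m r → Vertex m r → Bool
eqV (i , k) (j , l) = does (i ≟F j) ∧ does (k ≟F l)

Imat : ∀ {m r} → Mat m r
Imat x y = b2z (eqV x y)

Jmat : ∀ {m r} → Mat m r
Jmat x y = 1ℤ

-- E Γ = symmetric arcs; vec Γ = the remaining (asymmetric) arcs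
inE : ∀ {m r} → Digraph m r → Vertex m r → Vertex m r → Bool
inE arc x y = arc x y ∧ arc y x

inVec : ∀ {m r} → Digraph m r → Vertex m r → Vertex m r → Bool
inVec arc x y = arc x y ∧ not (arc y x)

A₀ : ∀ {m r} → Digraph m r → Mat m r
A₀ arc x y = b2z (inE arc x y)

A₁ : ∀ {m r} → Digraph m r → Mat m r
A₁ arc x y = b2z (inVec arc x y)

Amat : ∀ {m r} → Digraph m r → Fin 2 → Mat m r
Amat arc zero = A₀ arc
Amat arc (suc zero) = A₁ arc

idx : Fin 2 → Fin 2 → Fin 3
idx zero zero = zero
idx zero (suc zero) = suc zero
idx (suc zero) zero = suc zero
idx (suc zero) (suc zero) = suc (suc zero)

tδ : ℤ → Fin 2 → Fin 2 → ℤ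
tδ t zero zero = t
tδ t zero (suc zero) = 0ℤ
tδ t (suc zero) zero = 0ℤ
tδ t (suc zero) (suc zero) = 0ℤ

outdeg indeg : ∀ {m r} → Digraph m r → Vertex m r → ℕ
outdeg arc x = countV (λ y → arc x y)
indeg arc x = countV (λ y → arc y x)

IsRegular : ∀ {m r} → Digraph m r → Set
IsRegular {m} {r} arc = Σ ℕ λ k → (x : Vertex m r) → outdeg arc x ≡ k × indeg arc x ≡ k

IsDoublyRegularWith : ∀ {m r} → Digraph m r → ℤ → (α β γ η : Fin 3 → ℤ) → Set
IsDoublyRegularWith {m} {r} arc t α β γ η =
  (i j : Fin 2) → (x y : Vertex m r) →
    (Amat arc i · Amat arc j) x y ≡
      tδ t i j * Imat x y
      + α (idx i j) * A₁ arc x y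
      + β (idx i j) * (A₁ arc ᵀ) x y
      + γ (idx i j) * A₀ arc x y
      + η (idx i j) * (Jmat x y - Imat x y - A₁ arc x y - (A₁ arc ᵀ) x y - A₀ arc x y)

Aplus : ∀ {m r} → Digraph m r → Vertex m r → Fin m → ℕ
Aplus {m} {r} arc x j = countFin r (λ k → inVec arc x (j , k))

{-# OPTIONS --safe #-}
-- Sort the out-neighbours z of x in vec Γ by how z meets y: exactly one of
-- "z lies in the part of y", z → y in vec Γ, y → z in vec Γ, z ↔ y holds.
-- Summing over z gives
--   d = |A⁺_{part y}(x)| + (A₁A₁)(x,y) + (A₁A₁ᵀ)(x,y) + (A₁A₀)(x,y),
-- where d = k - t is the out-degree of vec Γ, because the A₀-row sums are
-- (A₀A₀)(x,x) = t. In the difference of this identity and its mirror image under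
-- x ↔ y the symmetric term A₁A₁ᵀ cancels, and double regularity gives
-- (AᵢAⱼ)(y,x) - (AᵢAⱼ)(x,y) = (β - α)(A₁(x,y) - A₁(y,x)).
module Submission where

open import Defs
open import Data.Nat using (ℕ; zero; suc; _≤_)
open import Data.Fin using (Fin; zero; suc; _≟_; punchIn)
open import Data.Fin.Properties using (punchInᵢ≢i)
open import Data.Product using (_×_; _,_; proj₁; proj₂)
open import Data.Bool using (Bool; true; false; _∧_; _∨_; not)
open import Data.Bool.Properties using (∧-comm; ∧-inverseʳ)
open import Data.Empty using (⊥-elim)
open import Data.Integer using (ℤ; +_; _+_; _-_; _*_; 0ℤ; 1ℤ)
open import Data.Integer.Properties
  using (+-*-semiring; +-identityˡ; +-identityʳ; *-identityʳ; *-zeroʳ; *-comm; +-injective; i-j≡0⇒i≡j)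
open import Data.Integer.Tactic.RingSolver using (solve-∀)
open import Algebra.Properties.Semiring.Sum +-*-semiring
  using (sum; sum-cong-≗; ∑-distrib-+; *-distribʳ-sum; sum-remove; sum-replicate-zero)
open import Function using (_∘_)
open import Relation.Binary.PropositionalEquality
  using (_≡_; _≢_; _≗_; refl; sym; trans; cong; cong₂; module ≡-Reasoning)
open import Relation.Nullary using (does; yes; no)
open import Relation.Nullary.Decidable using (dec-true; dec-false)

open ≡-Reasoning

sumFin≡sum : ∀ n (f : Fin n → ℤ) → sumFin n f ≡ sum f
sumFin≡sum zero    f = refl
sumFin≡sum (suc n) f = cong (_+_ (f zero)) (sumFin≡sum n (f ∘ suc))

sumFin-cong : ∀ n {f g : Fin n → ℤ} → f ≗ g → sumFin n f ≡ sumFin n g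
sumFin-cong n {f} {g} f≗g =
  trans (sumFin≡sum n f) (trans (sum-cong-≗ f≗g) (sym (sumFin≡sum n g)))

sumFin-distrib-+ : ∀ n (f g : Fin n → ℤ) →
  sumFin n (λ i → f i + g i) ≡ sumFin n f + sumFin n g
sumFin-distrib-+ n f g =
  trans (sumFin≡sum n _) (trans (∑-distrib-+ f g) (sym (cong₂ _+_ (sumFin≡sum n f) (sumFin≡sum n g))))

sumFin-distribʳ-* : ∀ n (f : Fin n → ℤ) c → sumFin n f * c ≡ sumFin n (λ i → f i * c)
sumFin-distribʳ-* n f c =
  trans (cong (_* c) (sumFin≡sum n f)) (trans (*-distribʳ-sum c f) (sym (sumFin≡sum n _)))

sumFin-δ : ∀ n (f : Fin n → ℤ) j → sumFin n (λ i → f i * b2z (does (i ≟ j))) ≡ f j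
sumFin-δ (suc n) f j = begin
  sumFin (suc n) δf          ≡⟨ sumFin≡sum (suc n) δf ⟩
  sum δf                     ≡⟨ sum-remove δf ⟩
  δf j + sum (δf ∘ punchIn j) ≡⟨ cong₂ _+_ δf-on (trans (sum-cong-≗ δf-off) (sum-replicate-zero n)) ⟩
  f j + 0ℤ                   ≡⟨ +-identityʳ (f j) ⟩
  f j                        ∎
  where
  δf : Fin (suc n) → ℤ
  δf i = f i * b2z (does (i ≟ j))
  δf-on : δf j ≡ f j
  δf-on rewrite dec-true (j ≟ j) refl = *-identityʳ (f j)
  δf-off : ∀ k → δf (punchIn j k) ≡ 0ℤ
  δf-off k rewrite dec-false (punchIn j k ≟ j) (punchInᵢ≢i j k) = *-zeroʳ (f (punchIn j k))

sumFin-b2z : ∀ n (f : Fin n → Bool) → sumFin n (b2z ∘ f) ≡ + countFin n f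
sumFin-b2z zero    f = refl
sumFin-b2z (suc n) f with f zero
... | true  = cong (_+_ 1ℤ) (sumFin-b2z n (f ∘ suc))
... | false = trans (+-identityˡ _) (sumFin-b2z n (f ∘ suc))

+-sumℕ : ∀ n (f : Fin n → ℕ) → + sumℕ n f ≡ sumFin n (+_ ∘ f)
+-sumℕ zero    f = refl
+-sumℕ (suc n) f = cong (_+_ (+ f zero)) (+-sumℕ n (f ∘ suc))

difference-of-balanced : ∀ a b p p′ s q q′ →
  a + p + s + q ≡ b + p′ + s + q′ → a - b ≡ (p′ - p) + (q′ - q)
difference-of-balanced a b p p′ s q q′ balanced = begin
  a - b                                   ≡⟨ rearrange a b p p′ s q q′ ⟩
  lhs - rhs + ((p′ - p) + (q′ - q))       ≡⟨ cong (λ w → w - rhs + ((p′ - p) + (q′ - q))) balanced ⟩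
  rhs - rhs + ((p′ - p) + (q′ - q))       ≡⟨ cancel rhs ((p′ - p) + (q′ - q)) ⟩
  (p′ - p) + (q′ - q)                     ∎
  where
  lhs rhs : ℤ
  lhs = a + p + s + q
  rhs = b + p′ + s + q′
  rearrange : ∀ a b p p′ s q q′ →
    a - b ≡ (a + p + s + q) - (b + p′ + s + q′) + ((p′ - p) + (q′ - q))
  rearrange = solve-∀
  cancel : ∀ u v → u - u + v ≡ v
  cancel = solve-∀

does-≟-sym : ∀ {n} (i j : Fin n) → does (i ≟ j) ≡ does (j ≟ i)
does-≟-sym i j with i ≟ j | j ≟ i
... | yes _   | yes _   = refl
... | no  _   | no  _   = refl
... | yes i≡j | no  j≢i = ⊥-elim (j≢i (sym i≡j))
... | no  i≢j | yes j≡i = ⊥-elim (i≢j (sym j≡i))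

b2z-idem : ∀ c → b2z c * b2z c ≡ b2z c
b2z-idem true  = refl
b2z-idem false = refl

b2z-split : ∀ a b → b2z a ≡ b2z (a ∧ not b) + b2z (a ∧ b)
b2z-split true  true  = refl
b2z-split true  false = refl
b2z-split false b     = refl

module _ {m r : ℕ} where

  sumV-cong : {f g : Vertex m r → ℤ} → f ≗ g → sumV f ≡ sumV g
  sumV-cong f≗g = sumFin-cong m (λ i → sumFin-cong r (λ k → f≗g (i , k)))

  sumV-distrib-+ : (f g : Vertex m r → ℤ) → sumV (λ z → f z + g z) ≡ sumV f + sumV g
  sumV-distrib-+ f g =
    trans (sumFin-cong m (λ i → sumFin-distrib-+ r _ _)) (sumFin-distrib-+ m _ _)

  sumV-distrib-+₄ : (f g h k : Vertex m r → ℤ) →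
    sumV (λ z → f z + g z + h z + k z) ≡ sumV f + sumV g + sumV h + sumV k
  sumV-distrib-+₄ f g h k = begin
    sumV (λ z → f z + g z + h z + k z)      ≡⟨ sumV-distrib-+ _ k ⟩
    sumV (λ z → f z + g z + h z) + sumV k   ≡⟨ cong (_+ sumV k) (sumV-distrib-+ _ h) ⟩
    sumV (λ z → f z + g z) + sumV h + sumV k ≡⟨ cong (λ s → s + sumV h + sumV k) (sumV-distrib-+ f g) ⟩
    sumV f + sumV g + sumV h + sumV k       ∎

  rowSum : Mat m r → Vertex m r → ℤ
  rowSum A x = sumV (A x)

  samePart : Mat m r
  samePart x y = b2z (does (part x ≟ part y))

  Imat-sym : ∀ x y → Imat {m} {r} x y ≡ Imat y x
  Imat-sym (i , k) (j , l) = cong b2z (cong₂ _∧_ (does-≟-sym i j) (does-≟-sym k l))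

  Imat-diag : ∀ x → Imat {m} {r} x x ≡ 1ℤ
  Imat-diag (i , k) rewrite dec-true (i ≟ i) refl | dec-true (k ≟ k) refl = refl

  ·ᵀ-sym : (A : Mat m r) → ∀ x y → (A · (A ᵀ)) x y ≡ (A · (A ᵀ)) y x
  ·ᵀ-sym A x y = sumV-cong (λ z → *-comm (A x z) (A y z))

module _ {m r : ℕ} (Γ : Digraph m r) where

  A₀-sym : ∀ x y → A₀ Γ x y ≡ A₀ Γ y x
  A₀-sym x y = cong b2z (∧-comm (Γ x y) (Γ y x))

  A₁-diag : ∀ x → A₁ Γ x x ≡ 0ℤ
  A₁-diag x = cong b2z (∧-inverseʳ (Γ x x))

  A₀-diag : IsTeamSMD Γ → ∀ x → A₀ Γ x x ≡ 0ℤ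
  A₀-diag team x rewrite proj₁ (team x x) refl = refl

  +Aplus≡A₁·samePart : ∀ x y → + Aplus Γ x (part y) ≡ (A₁ Γ · samePart) x y
  +Aplus≡A₁·samePart x y = begin
    + Aplus Γ x (part y)                                ≡⟨ sumFin-b2z r _ ⟨
    sumFin r (λ k → A₁ Γ x (part y , k))                ≡⟨ sumFin-δ m inPart (part y) ⟨
    sumFin m (λ i → inPart i * b2z (does (i ≟ part y))) ≡⟨ sumFin-cong m (λ i → sumFin-distribʳ-* r _ _) ⟩
    (A₁ Γ · samePart) x y                               ∎
    where
    inPart : Fin m → ℤ
    inPart i = sumFin r (λ k → A₁ Γ x (i , k))

  samePart-partition : IsTeamSMD Γ → ∀ z y →
    samePart z y + A₁ Γ z y + A₁ Γ y z + A₀ Γ z y ≡ 1ℤ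
  samePart-partition team z y with part z ≟ part y
  ... | yes same rewrite proj₁ (team z y) same | proj₁ (team y z) (sym same) = refl
  ... | no differ = exactlyOne (Γ z y) (Γ y z) (proj₂ (team z y) differ)
    where
    exactlyOne : ∀ a b → (a ∨ b) ≡ true →
      0ℤ + b2z (a ∧ not b) + b2z (b ∧ not a) + b2z (a ∧ b) ≡ 1ℤ
    exactlyOne true  true  _ = refl
    exactlyOne true  false _ = refl
    exactlyOne false true  _ = refl

  rowSum-A₁-split : IsTeamSMD Γ → ∀ x y → rowSum (A₁ Γ) x ≡
    (A₁ Γ · samePart) x y + (A₁ Γ · A₁ Γ) x y + (A₁ Γ · (A₁ Γ ᵀ)) x y + (A₁ Γ · A₀ Γ) x y
  rowSum-A₁-split team x y = begin
    sumV (λ z → A₁ Γ x z)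
      ≡⟨ sumV-cong (λ z → trans (sym (*-identityʳ _)) (cong (A₁ Γ x z *_) (sym (samePart-partition team z y)))) ⟩
    sumV (λ z → A₁ Γ x z * (samePart z y + A₁ Γ z y + A₁ Γ y z + A₀ Γ z y))
      ≡⟨ sumV-cong (λ z → distrib₄ (A₁ Γ x z) _ _ _ _) ⟩
    sumV (λ z → via samePart z + via (A₁ Γ) z + via (A₁ Γ ᵀ) z + via (A₀ Γ) z)
      ≡⟨ sumV-distrib-+₄ (via samePart) (via (A₁ Γ)) (via (A₁ Γ ᵀ)) (via (A₀ Γ)) ⟩
    (A₁ Γ · samePart) x y + (A₁ Γ · A₁ Γ) x y + (A₁ Γ · (A₁ Γ ᵀ)) x y + (A₁ Γ · A₀ Γ) x y ∎
    where
    via : Mat m r → Vertex m r → ℤ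
    via B z = A₁ Γ x z * B z y
    distrib₄ : ∀ a b c d e → a * (b + c + d + e) ≡ a * b + a * c + a * d + a * e
    distrib₄ = solve-∀

  +outdeg≡rowSum-A₁+rowSum-A₀ : ∀ x → + outdeg Γ x ≡ rowSum (A₁ Γ) x + rowSum (A₀ Γ) x
  +outdeg≡rowSum-A₁+rowSum-A₀ x = begin
    + outdeg Γ x                                 ≡⟨ +-sumℕ m _ ⟩
    sumFin m (λ i → + countFin r (λ k → Γ x (i , k))) ≡⟨ sumFin-cong m (λ i → sumFin-b2z r _) ⟨
    sumV (λ z → b2z (Γ x z))                     ≡⟨ sumV-cong (λ z → b2z-split (Γ x z) (Γ z x)) ⟩
    sumV (λ z → A₁ Γ x z + A₀ Γ x z)             ≡⟨ sumV-distrib-+ (A₁ Γ x) (A₀ Γ x) ⟩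
    rowSum (A₁ Γ) x + rowSum (A₀ Γ) x            ∎

  module _ {t : ℤ} {α β γ η : Fin 3 → ℤ} (dr : IsDoublyRegularWith Γ t α β γ η) where

    rowSum-A₀≡t : IsTeamSMD Γ → ∀ x → rowSum (A₀ Γ) x ≡ t
    rowSum-A₀≡t team x = begin
      rowSum (A₀ Γ) x ≡⟨ sumV-cong (λ z → trans (sym (b2z-idem _)) (cong (A₀ Γ x z *_) (A₀-sym x z))) ⟩
      (A₀ Γ · A₀ Γ) x x ≡⟨ dr zero zero x x ⟩
      _               ≡⟨ onDiagonal (Imat-diag x) (A₁-diag x) (A₀-diag team x) ⟩
      t               ∎
      where
      onDiagonal : ∀ {i a₁ a₀} → i ≡ 1ℤ → a₁ ≡ 0ℤ → a₀ ≡ 0ℤ →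
        t * i + α zero * a₁ + β zero * a₁ + γ zero * a₀ + η zero * (1ℤ - i - a₁ - a₁ - a₀) ≡ t
      onDiagonal refl refl refl = evaluate t (α zero) (β zero) (γ zero) (η zero)
        where
        evaluate : ∀ t a b c d →
          t * 1ℤ + a * 0ℤ + b * 0ℤ + c * 0ℤ + d * (1ℤ - 1ℤ - 0ℤ - 0ℤ - 0ℤ) ≡ t
        evaluate = solve-∀

    rowSum-A₁≡k-t : IsTeamSMD Γ → ∀ {k} → (∀ x → outdeg Γ x ≡ k) → ∀ x → rowSum (A₁ Γ) x ≡ + k - t
    rowSum-A₁≡k-t team {k} outdeg≡k x = begin
      rowSum (A₁ Γ) x                                       ≡⟨ addSub (rowSum (A₁ Γ) x) (rowSum (A₀ Γ) x) ⟨
      rowSum (A₁ Γ) x + rowSum (A₀ Γ) x - rowSum (A₀ Γ) x   ≡⟨ cong₂ _-_ (sym (+outdeg≡rowSum-A₁+rowSum-A₀ x)) (rowSum-A₀≡t team x) ⟩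
      + outdeg Γ x - t                                      ≡⟨ cong (λ d → + d - t) (outdeg≡k x) ⟩
      + k - t                                               ∎
      where
      addSub : ∀ a b → a + b - b ≡ a
      addSub = solve-∀

    Amat·Amat-skew : ∀ i j x y →
      (Amat Γ i · Amat Γ j) y x - (Amat Γ i · Amat Γ j) x y
        ≡ (β (idx i j) - α (idx i j)) * (A₁ Γ x y - A₁ Γ y x)
    Amat·Amat-skew i j x y =
      trans (cong₂ _-_ (dr i j y x) (dr i j x y)) (skew (Imat-sym y x) (A₀-sym y x))
      where
      τ a b c d p q : ℤ
      τ = tδ t i j
      a = α (idx i j)
      b = β (idx i j)
      c = γ (idx i j)
      d = η (idx i j)
      p = A₁ Γ x y
      q = A₁ Γ y x
      skew : ∀ {e e′ s s′} → e′ ≡ e → s′ ≡ s →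
        τ * e′ + a * q + b * p + c * s′ + d * (1ℤ - e′ - q - p - s′)
          - (τ * e + a * p + b * q + c * s + d * (1ℤ - e - p - q - s))
          ≡ (b - a) * (p - q)
      skew {e} {s = s} refl refl = antisymmetric τ a b c d e s p q
        where
        antisymmetric : ∀ τ a b c d e s p q →
          τ * e + a * q + b * p + c * s + d * (1ℤ - e - q - p - s)
            - (τ * e + a * p + b * q + c * s + d * (1ℤ - e - p - q - s))
            ≡ (b - a) * (p - q)
        antisymmetric = solve-∀

    +Aplus-skew : IsTeamSMD Γ → ∀ {k} → (∀ x → outdeg Γ x ≡ k) → ∀ x y →
      + Aplus Γ x (part y) - + Aplus Γ y (part x)
        ≡ (β (suc zero) + β (suc (suc zero)) - α (suc zero) - α (suc (suc zero))) * (A₁ Γ x y - A₁ Γ y x)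
    +Aplus-skew team outdeg≡k x y = begin
      + Aplus Γ x (part y) - + Aplus Γ y (part x)
        ≡⟨ cong₂ _-_ (+Aplus≡A₁·samePart x y) (+Aplus≡A₁·samePart y x) ⟩
      (A₁ Γ · samePart) x y - (A₁ Γ · samePart) y x
        ≡⟨ difference-of-balanced ((A₁ Γ · samePart) x y) ((A₁ Γ · samePart) y x) ((A₁ Γ · A₁ Γ) x y) ((A₁ Γ · A₁ Γ) y x)
                                  ((A₁ Γ · (A₁ Γ ᵀ)) x y) ((A₁ Γ · A₀ Γ) x y) ((A₁ Γ · A₀ Γ) y x) balanced ⟩
      ((A₁ Γ · A₁ Γ) y x - (A₁ Γ · A₁ Γ) x y) + ((A₁ Γ · A₀ Γ) y x - (A₁ Γ · A₀ Γ) x y)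
        ≡⟨ cong₂ _+_ (Amat·Amat-skew (suc zero) (suc zero) x y) (Amat·Amat-skew (suc zero) zero x y) ⟩
      (β (suc (suc zero)) - α (suc (suc zero))) * δ + (β (suc zero) - α (suc zero)) * δ
        ≡⟨ collect δ (α (suc zero)) (α (suc (suc zero))) (β (suc zero)) (β (suc (suc zero))) ⟩
      (β (suc zero) + β (suc (suc zero)) - α (suc zero) - α (suc (suc zero))) * δ ∎
      where
      δ : ℤ
      δ = A₁ Γ x y - A₁ Γ y x
      balanced : (A₁ Γ · samePart) x y + (A₁ Γ · A₁ Γ) x y + (A₁ Γ · (A₁ Γ ᵀ)) x y + (A₁ Γ · A₀ Γ) x y
               ≡ (A₁ Γ · samePart) y x + (A₁ Γ · A₁ Γ) y x + (A₁ Γ · (A₁ Γ ᵀ)) x y + (A₁ Γ · A₀ Γ) y x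
      balanced = begin
        _                 ≡⟨ rowSum-A₁-split team x y ⟨
        rowSum (A₁ Γ) x   ≡⟨ trans (rowSum-A₁≡k-t team outdeg≡k x) (sym (rowSum-A₁≡k-t team outdeg≡k y)) ⟩
        rowSum (A₁ Γ) y   ≡⟨ rowSum-A₁-split team y x ⟩
        _                 ≡⟨ cong (λ s → (A₁ Γ · samePart) y x + (A₁ Γ · A₁ Γ) y x + s + (A₁ Γ · A₀ Γ) y x)
                                  (·ᵀ-sym (A₁ Γ) y x) ⟩
        _                 ∎
      collect : ∀ δ a₁ a₂ b₁ b₂ → (b₂ - a₂) * δ + (b₁ - a₁) * δ ≡ (b₁ + b₂ - a₁ - a₂) * δ
      collect = solve-∀

  A₁-skew-vec : ∀ x y → inVec Γ x y ≡ true → A₁ Γ x y - A₁ Γ y x ≡ 1ℤ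
  A₁-skew-vec x y = asymmetric (Γ x y) (Γ y x)
    where
    asymmetric : ∀ a b → (a ∧ not b) ≡ true → b2z (a ∧ not b) - b2z (b ∧ not a) ≡ 1ℤ
    asymmetric true  false _ = refl
    asymmetric true  true  ()
    asymmetric false _     ()

  A₁-skew-E : ∀ x y → inE Γ x y ≡ true → A₁ Γ x y - A₁ Γ y x ≡ 0ℤ
  A₁-skew-E x y = symmetric (Γ x y) (Γ y x)
    where
    symmetric : ∀ a b → (a ∧ b) ≡ true → b2z (a ∧ not b) - b2z (b ∧ not a) ≡ 0ℤ
    symmetric true  true  _ = refl
    symmetric true  false ()
    symmetric false _     ()

lemma3p5 : (m r : ℕ) → 2 ≤ m → 2 ≤ r → (Γ : Digraph m r) →
    IsTeamSMD Γ → IsRegular Γ →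
    (t : ℤ) → (α β γ η : Fin 3 → ℤ) → IsDoublyRegularWith Γ t α β γ η →
    (x y : Vertex m r) → part x ≢ part y →
      ((inVec Γ x y ≡ true →
          + Aplus Γ x (part y) - + Aplus Γ y (part x)
            ≡ β (suc zero) + β (suc (suc zero)) - α (suc zero) - α (suc (suc zero)))
      × (inE Γ x y ≡ true → Aplus Γ x (part y) ≡ Aplus Γ y (part x)))
lemma3p5 m r _ _ Γ team (_ , regular) t α β γ η dr x y _ =
    (λ x→y → trans skew (trans (cong (c *_) (A₁-skew-vec Γ x y x→y)) (*-identityʳ c)))
  , (λ x↔y → +-injective (i-j≡0⇒i≡j _ _
      (trans skew (trans (cong (c *_) (A₁-skew-E Γ x y x↔y)) (*-zeroʳ c)))))
  where
  c : ℤ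
  c = β (suc zero) + β (suc (suc zero)) - α (suc zero) - α (suc (suc zero))
  skew : + Aplus Γ x (part y) - + Aplus Γ y (part x) ≡ c * (A₁ Γ x y - A₁ Γ y x)
  skew = +Aplus-skew Γ {t} {α} {β} {γ} {η} dr team (proj₁ ∘ regular) x y
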